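{- In the formal setting described in the context, let $\mu\in\mathbb{Q}(k)$ and write $\Psi(\mu)(\varphi)=q^{k/2}\sum_{n\ge0}\beta_n(k)q^n$. Then $\beta_0(k)=0$. Moreover, $\beta_1(k)=0$ if and only if $\mu=(\mu^*_{k+1})^{ -1}$, where $\mu^*_{k+1}=\frac{12(6k+5)(6k+13)}{(k+1)(k+2)}$ (i.e. $\mu_j^*=\frac{12(6j-1)(6j+7)}{j(j+1)}$ evaluated at $j=k+1$).
   Context: Let $k$ be an indeterminate and $K=\mathbb{Q}(k)$. Let $W$ be the set of formal expressions $q^{k/2}g$ with $g\in K((q^{1/2}))$. Operators on $W$: multiplication by elements of $K((q^{1/2}))$, and the shift $\psi(q^{k/2}g(k;q))=q^{(k+1)/2}g(k+1;q)$ (replace $k$ by $k+1$ in every coefficient and multiply by $q^{1/2}$). Here $E_4=1+240\sum\sigma_3(n)q^n$, $E_6=1-504\sum\sigma_5(n)q^n$, $\Delta^{ -1/2}=q^{ -1/2}\prod_{n\ge1}(1-q^n)^{ -12}$. For $\mu\in K$, $\Psi(\mu)=\psi^2+\mu\big(E_6\Delta^{ -1/2}\psi-1\big)$. Define $a_n(k)\in K$ by $\big(\frac{k^2}{4}-\frac1{12}\big)E_4+\frac1{12}\big(\frac{E_6}{E_4}\big)^2=\sum_{n\ge0}a_n(k)q^n$, $\alpha_0(k)=1$, $\alpha_n(k)=\frac{1}{n(n+k)}\sum_{m=1}^na_m(k)\alpha_{n-m}(k)$ for $n\ge1$, and $\varphi=q^{k/2}\sum_{n\ge0}\alpha_n(k)q^n$.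 -}

module Defs where

open import Data.Nat as ℕ using (ℕ; zero; suc)
open import Data.Nat.Divisibility using (_∣?_)
open import Data.Integer as ℤ using (ℤ; +_; -[1+_])
open import Data.Rational as Q using (ℚ; 0ℚ; 1ℚ)
open import Data.List using (List; []; _∷_; map; foldr; filter; upTo; head)
open import Data.List.Relation.Unary.All using (All)
open import Data.Maybe using (fromMaybe)
open import Data.Bool using (if_then_else_)
open import Relation.Binary.PropositionalEquality using (_≡_)
open import Relation.Nullary using (¬_)
open import Relation.Nullary.Decidable using (⌊_⌋)

-- Polynomials in k over ℚ : coefficient lists, lowest degree first.

Poly : Set
Poly = List ℚ

_+P_ : Poly → Poly → Poly
[] +P q = q
(a ∷ p) +P [] = a ∷ p
(a ∷ p) +P (b ∷ q) = (a Q.+ b) ∷ (p +P q)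

-P_ : Poly → Poly
-P p = map Q.-_ p

_*P_ : Poly → Poly → Poly
[] *P q = []
(a ∷ p) *P q = map (a Q.*_) q +P (0ℚ ∷ (p *P q))

IsZeroP : Poly → Set
IsZeroP p = All (λ c → c ≡ 0ℚ) p

_≈P_ : Poly → Poly → Set
p ≈P q = IsZeroP (p +P (-P q))

shiftP : Poly → Poly
shiftP [] = []
shiftP (c ∷ p) = (c ∷ []) +P ((1ℚ ∷ 1ℚ ∷ []) *P shiftP p)

-- K = ℚ(k) : fractions num/den of polynomials, equality by cross-multiplication.

record K : Set where
  constructor _//_
  field
    num : Poly
    den : Poly
open K public

ValidK : K → Set
ValidK x = ¬ IsZeroP (den x)

_≈K_ : K → K → Set
x ≈K y = (num x *P den y) ≈P (num y *P den x)

infixl 6 _+K_ _-K_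
infixl 7 _*K_ _/K_
infix 4 _≈K_

_+K_ : K → K → K
x +K y = ((num x *P den y) +P (num y *P den x)) // (den x *P den y)

-K_ : K → K
-K x = (-P num x) // den x

_-K_ : K → K → K
x -K y = x +K (-K y)

_*K_ : K → K → K
x *K y = (num x *P num y) // (den x *P den y)

_/K_ : K → K → K
x /K y = (num x *P den y) // (den x *P num y)

fromℚ : ℚ → K
fromℚ c = (c ∷ []) // (1ℚ ∷ [])

fromℕK : ℕ → K
fromℕK n = fromℚ ((+ n) Q./ 1)

0K 1K kK : K
0K = fromℚ 0ℚ
1K = fromℚ 1ℚ
kK = (0ℚ ∷ 1ℚ ∷ []) // (1ℚ ∷ [])

shiftK : K → K
shiftK x = shiftP (num x) // shiftP (den x)

sumK : List K → K
sumK = foldr _+K_ 0K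

Σ≤ : ℕ → (ℕ → K) → K
Σ≤ n f = sumK (map f (upTo (suc n)))

-- Power series in q over K : coefficient functions.

PS : Set
PS = ℕ → K

_*S_ : PS → PS → PS
(f *S g) n = Σ≤ n (λ i → f i *K g (n ℕ.∸ i))

_+S_ : PS → PS → PS
(f +S g) n = f n +K g n

scaleS : K → PS → PS
scaleS c f n = c *K f n

powS : PS → ℕ → PS
powS f zero = λ { zero → 1K ; (suc _) → 0K }
powS f (suc m) = f *S powS f m

-- course-of-values recursion: given F n [b_{n-1}, …, b_0] = b_n,
-- seqRev F n = [b_{n-1}, …, b_0]
seqRev : (ℕ → List K → K) → ℕ → List K
seqRev F zero = []
seqRev F (suc n) = F n (seqRev F n) ∷ seqRev F n

seqAt : (ℕ → List K → K) → ℕ → K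
seqAt F n = fromMaybe 0K (head (seqRev F (suc n)))

-- Σ_j f (j+1) * l_j   (for l = [b_{n-1}, …, b_0] this is Σ_{m=1}^{n} f m b_{n-m})
convRev : (ℕ → K) → List K → K
convRev f [] = 0K
convRev f (b ∷ l) = (f 1 *K b) +K convRev (λ j → f (suc j)) l

-- inverse of a power series with constant term 1
invS : PS → PS
invS f = seqAt (λ { zero l → 1K ; (suc n) l → -K convRev f l })

σ : ℕ → ℕ → ℕ
σ r n = foldr ℕ._+_ 0 (map (λ d → d ℕ.^ r) (filter (_∣? n) (map suc (upTo n))))

E4 : PS
E4 zero = 1K
E4 (suc n) = fromℕK (240 ℕ.* σ 3 (suc n))

E6 : PS
E6 zero = 1K
E6 (suc n) = -K fromℕK (504 ℕ.* σ 5 (suc n))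

mul1mq : ℕ → PS → PS
mul1mq j f m = if ⌊ j ℕ.≤? m ⌋ then f m -K f (m ℕ.∸ j) else f m

finProd : ℕ → PS
finProd zero = λ { zero → 1K ; (suc _) → 0K }
finProd (suc N) = mul1mq (suc N) (finProd N)

-- ∏_{n≥1} (1 - q^n) : its q^m coefficient is that of the finite product up to n = m
eulerProd : PS
eulerProd m = finProd m m

invEta12 : PS
invEta12 = invS (powS eulerProd 12)

-- Laurent series in q^{1/2} over K:  Σ_{i≥0} coeffs i · q^{(val + i)/2}

record LS : Set where
  constructor mkLS
  field
    val    : ℤ
    coeffs : ℕ → K
open LS public

coef : LS → ℤ → K
coef a e with val a ℤ.≤? e
... | Relation.Nullary.yes _ = coeffs a ℤ.∣ e ℤ.- val a ∣
... | Relation.Nullary.no  _ = 0K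

_+L_ : LS → LS → LS
a +L b = mkLS v (λ i → coef a (v ℤ.+ + i) +K coef b (v ℤ.+ + i))
  where v = val a ℤ.⊓ val b

-L_ : LS → LS
-L a = mkLS (val a) (λ i → -K coeffs a i)

_*L_ : LS → LS → LS
a *L b = mkLS (val a ℤ.+ val b) (λ n → Σ≤ n (λ i → coeffs a i *K coeffs b (n ℕ.∸ i)))

scaleL : K → LS → LS
scaleL c a = mkLS (val a) (λ i → c *K coeffs a i)

-- a power series in q viewed in q^{1/2}
spread : PS → ℕ → K
spread f zero = f zero
spread f (suc zero) = 0K
spread f (suc (suc i)) = spread (λ n → f (suc n)) i

fromPS : PS → LS
fromPS f = mkLS (+ 0) (spread f)

E4L E6L Δ⁻½ : LS
E4L = fromPS E4
E6L = fromPS E6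
Δ⁻½ = mkLS -[1+ 0 ] (spread invEta12)

-- W : an element q^{k/2} g of W is represented by g ∈ K((q^{1/2})).

W : Set
W = LS

-- ψ(q^{k/2} g(k;q)) = q^{(k+1)/2} g(k+1;q), i.e. g ↦ q^{1/2} g(k+1;q)
ψ : W → W
ψ g = mkLS (val g ℤ.+ + 1) (λ i → shiftK (coeffs g i))

Ψ : K → W → W
Ψ μ w = ψ (ψ w) +L scaleL μ (((E6L *L Δ⁻½) *L ψ w) +L (-L w))

aSeq : PS
aSeq = (scaleS c E4) +S (scaleS (fromℚ (+ 1 Q./ 12)) (powS (E6 *S invS E4) 2))
  where c = (kK *K kK) /K fromℕK 4 -K fromℚ (+ 1 Q./ 12)

α : ℕ → K
α = seqAt step
  where
  step : ℕ → List K → K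
  step zero l = 1K
  step (suc n) l = convRev aSeq l /K (fromℕK (suc n) *K (fromℕK (suc n) +K kK))

φ : W
φ = fromPS α

-- β_n(μ) : the coefficient of q^{k/2 + n} in Ψ(μ)(φ)
β : ℕ → K → K
β n μ = coef (Ψ μ φ) (+ (2 ℕ.* n))

μ* : K → K
μ* j = (fromℕK 12 *K (fromℕK 6 *K j -K 1K) *K (fromℕK 6 *K j +K fromℕK 7)) /K (j *K (j +K 1K))

module Submission where

-- Write Ψ(μ)φ = ψ²φ + μ·Y with Y = E₆Δ^{-1/2}ψφ - φ.  Since ψ²φ starts at
-- q^{k/2+1}, one gets β₀ = μ·Y₀ and β₁ = (ψ²φ)₀ + μ·Y₁ definitionally, where
-- (ψ²φ)₀ = α₀(k+2) = 1.  Evaluating the series gives Y₀ = 0 and Y₁ = -μ*_{k+1}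
-- in ℚ(k); these three identities are finite computations in ℚ[k].  It remains
-- the field-level fact  1 + μ·(-M) = 0 ⇔ μ = 1/M.

open import Defs
open import Data.Nat as ℕ using (ℕ; zero; suc)
open import Data.Integer using (+_)
open import Data.Rational as Q using (ℚ; 0ℚ; 1ℚ)
open import Data.Rational.Properties as QP using ()
open import Data.Rational.Solver using (module +-*-Solver)
open import Data.List using ([]; _∷_; map)
open import Data.List.Relation.Unary.All using ([]; _∷_; all?)
open import Data.Product using (_×_; _,_; proj₁; proj₂)
open import Function.Bundles using (_⇔_; mk⇔; Equivalence)
open import Function.Properties.Equivalence using () renaming (trans to ⇔-trans; sym to ⇔-sym)
open import Function.Related.Propositional using (module EquationalReasoning)
open import Relation.Binary.Bundles using (Setoid)
import Relation.Binary.Reasoning.Setoid as SetoidReasoning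
open import Relation.Binary.PropositionalEquality
open import Relation.Nullary.Decidable using (True; toWitness)

open +-*-Solver

-- §1 Coefficientwise equality of polynomials

coeff : Poly → ℕ → ℚ
coeff []      i       = 0ℚ
coeff (a ∷ p) zero    = a
coeff (a ∷ p) (suc i) = coeff p i

-- equality in ℚ[k]: coefficient lists may differ by trailing zeros
infix 4 _~_
record _~_ (p q : Poly) : Set where
  constructor mk~
  field coeff-≡ : ∀ i → coeff p i ≡ coeff q i
open _~_ public

~-refl : ∀ {p} → p ~ p
~-refl = mk~ λ i → refl

~-sym : ∀ {p q} → p ~ q → q ~ p
~-sym e = mk~ λ i → sym (coeff-≡ e i)

~-trans : ∀ {p q r} → p ~ q → q ~ r → p ~ r
~-trans e f = mk~ λ i → trans (coeff-≡ e i) (coeff-≡ f i)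

~-setoid : Setoid _ _
~-setoid = record { Carrier = Poly ; _≈_ = _~_
                  ; isEquivalence = record { refl = ~-refl ; sym = ~-sym ; trans = ~-trans } }

~-resp : ∀ {p p′ q q′} → p ~ p′ → q ~ q′ → p ~ q ⇔ p′ ~ q′
~-resp p~p′ q~q′ = mk⇔ (λ p~q → ~-trans (~-sym p~p′) (~-trans p~q q~q′))
                       (λ p′~q′ → ~-trans p~p′ (~-trans p′~q′ (~-sym q~q′)))

~-sym⇔ : ∀ {p q} → p ~ q ⇔ q ~ p
~-sym⇔ = mk⇔ ~-sym ~-sym

∷-cong : ∀ {a b p q} → a ≡ b → p ~ q → (a ∷ p) ~ (b ∷ q)
∷-cong a≡b e = mk~ λ { zero → a≡b ; (suc i) → coeff-≡ e i }

~[]-tail : ∀ {a p} → (a ∷ p) ~ [] → p ~ []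
~[]-tail e = mk~ λ i → coeff-≡ e (suc i)

k·-zero : ∀ {p} → p ~ [] → (0ℚ ∷ p) ~ []
k·-zero e = mk~ λ { zero → refl ; (suc i) → coeff-≡ e i }

-- §2 The ring laws of ℚ[k] up to coefficientwise equality

coeff-+ : ∀ p q i → coeff (p +P q) i ≡ coeff p i Q.+ coeff q i
coeff-+ []      q       i       = sym (QP.+-identityˡ _)
coeff-+ (a ∷ p) []      i       = sym (QP.+-identityʳ _)
coeff-+ (a ∷ p) (b ∷ q) zero    = refl
coeff-+ (a ∷ p) (b ∷ q) (suc i) = coeff-+ p q i

coeff-neg : ∀ p i → coeff (-P p) i ≡ Q.- coeff p i
coeff-neg []      i       = refl
coeff-neg (a ∷ p) zero    = refl
coeff-neg (a ∷ p) (suc i) = coeff-neg p i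

coeff-scale : ∀ a p i → coeff (map (a Q.*_) p) i ≡ a Q.* coeff p i
coeff-scale a []      i       = sym (QP.*-zeroʳ a)
coeff-scale a (b ∷ p) zero    = refl
coeff-scale a (b ∷ p) (suc i) = coeff-scale a p i

coeff-* : ∀ a p q i → coeff ((a ∷ p) *P q) i ≡ a Q.* coeff q i Q.+ coeff (0ℚ ∷ (p *P q)) i
coeff-* a p q i = trans (coeff-+ (map (a Q.*_) q) (0ℚ ∷ (p *P q)) i) (cong (Q._+ _) (coeff-scale a q i))

k·-scale : ∀ a p → 0ℚ ∷ map (a Q.*_) p ~ map (a Q.*_) (0ℚ ∷ p)
k·-scale a p = ∷-cong (sym (QP.*-zeroʳ a)) ~-refl

+-cong : ∀ {p p′ q q′} → p ~ p′ → q ~ q′ → p +P q ~ p′ +P q′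
+-cong {p} {p′} {q} {q′} e f = mk~ λ i →
  trans (coeff-+ p q i) (trans (cong₂ Q._+_ (coeff-≡ e i) (coeff-≡ f i)) (sym (coeff-+ p′ q′ i)))

neg-cong : ∀ {p p′} → p ~ p′ → -P p ~ -P p′
neg-cong {p} {p′} e = mk~ λ i → trans (coeff-neg p i) (trans (cong Q.-_ (coeff-≡ e i)) (sym (coeff-neg p′ i)))

*-zeroʳ : ∀ p → p *P [] ~ []
*-zeroʳ []      = ~-refl
*-zeroʳ (a ∷ p) = k·-zero (*-zeroʳ p)

*-absorbˡ : ∀ {p} q → p ~ [] → p *P q ~ []
*-absorbˡ {[]}    q e = ~-refl
*-absorbˡ {a ∷ p} q e = mk~ λ i → trans (coeff-* a p q i) (trans
  (cong₂ Q._+_ (trans (cong (Q._* coeff q i) (coeff-≡ e zero)) (QP.*-zeroˡ (coeff q i)))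
               (coeff-≡ (k·-zero (*-absorbˡ q (~[]-tail e))) i))
  (QP.+-identityˡ 0ℚ))

*-congʳ : ∀ p {q q′} → q ~ q′ → p *P q ~ p *P q′
*-congʳ []      e = ~-refl
*-congʳ (a ∷ p) {q} {q′} e = mk~ λ i → trans (coeff-* a p q i) (trans
  (cong₂ Q._+_ (cong (a Q.*_) (coeff-≡ e i)) (coeff-≡ (∷-cong refl (*-congʳ p e)) i))
  (sym (coeff-* a p q′ i)))

*-congˡ : ∀ {p p′} q → p ~ p′ → p *P q ~ p′ *P q
*-congˡ {[]}    {[]}     q e = ~-refl
*-congˡ {[]}    {b ∷ p′} q e = ~-sym (*-absorbˡ q (~-sym e))
*-congˡ {a ∷ p} {[]}     q e = *-absorbˡ q e
*-congˡ {a ∷ p} {b ∷ p′} q e = mk~ λ i → trans (coeff-* a p q i) (trans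
  (cong₂ Q._+_ (cong (Q._* coeff q i) (coeff-≡ e zero))
               (coeff-≡ (∷-cong refl (*-congˡ q (tail-~ e))) i))
  (sym (coeff-* b p′ q i)))
  where
  tail-~ : (a ∷ p) ~ (b ∷ p′) → p ~ p′
  tail-~ e = mk~ λ i → coeff-≡ e (suc i)

*-consʳ : ∀ p b q → p *P (b ∷ q) ~ map (b Q.*_) p +P (0ℚ ∷ (p *P q))
*-consʳ []      b q = ~-sym (k·-zero ~-refl)
*-consʳ (a ∷ p) b q = mk~ λ
  { zero    → trans (coeff-* a p (b ∷ q) zero) (cong (Q._+ 0ℚ) (QP.*-comm a b))
  ; (suc i) → begin
      coeff ((a ∷ p) *P (b ∷ q)) (suc i)
    ≡⟨ coeff-* a p (b ∷ q) (suc i) ⟩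
      a Q.* coeff q i Q.+ coeff (p *P (b ∷ q)) i
    ≡⟨ cong (a Q.* coeff q i Q.+_) (coeff-≡ (*-consʳ p b q) i) ⟩
      a Q.* coeff q i Q.+ coeff (map (b Q.*_) p +P (0ℚ ∷ (p *P q))) i
    ≡⟨ cong (a Q.* coeff q i Q.+_) (trans (coeff-+ (map (b Q.*_) p) _ i) (cong (Q._+ _) (coeff-scale b p i))) ⟩
      a Q.* coeff q i Q.+ (b Q.* coeff p i Q.+ coeff (0ℚ ∷ (p *P q)) i)
    ≡⟨ solve 5 (λ a x b y z → a :* x :+ (b :* y :+ z) := b :* y :+ (a :* x :+ z)) refl a (coeff q i) b (coeff p i) _ ⟩
      b Q.* coeff p i Q.+ (a Q.* coeff q i Q.+ coeff (0ℚ ∷ (p *P q)) i)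
    ≡⟨ sym (cong₂ Q._+_ (coeff-scale b p i) (coeff-* a p q i)) ⟩
      coeff (map (b Q.*_) p) i Q.+ coeff ((a ∷ p) *P q) i
    ≡⟨ sym (coeff-+ (map (b Q.*_) p) _ i) ⟩
      coeff (map (b Q.*_) (a ∷ p) +P (0ℚ ∷ ((a ∷ p) *P q))) (suc i)
    ∎ }
  where open ≡-Reasoning

*-comm : ∀ p q → p *P q ~ q *P p
*-comm []      q = ~-sym (*-zeroʳ q)
*-comm (a ∷ p) q = ~-sym (~-trans (*-consʳ q a p) (+-cong ~-refl (∷-cong refl (*-comm q p))))

*-distribʳ : ∀ p q r → (p +P q) *P r ~ (p *P r) +P (q *P r)
*-distribʳ []      q       r = mk~ λ i → trans (sym (QP.+-identityˡ _)) (sym (coeff-+ [] (q *P r) i))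
*-distribʳ (a ∷ p) []      r = mk~ λ i → trans (sym (QP.+-identityʳ _)) (sym (coeff-+ ((a ∷ p) *P r) [] i))
*-distribʳ (a ∷ p) (b ∷ q) r = mk~ λ i → begin
    coeff (((a Q.+ b) ∷ (p +P q)) *P r) i
  ≡⟨ coeff-* (a Q.+ b) (p +P q) r i ⟩
    (a Q.+ b) Q.* coeff r i Q.+ coeff (0ℚ ∷ ((p +P q) *P r)) i
  ≡⟨ cong ((a Q.+ b) Q.* coeff r i Q.+_) (coeff-≡ (∷-cong refl (*-distribʳ p q r)) i) ⟩
    (a Q.+ b) Q.* coeff r i Q.+ coeff ((0ℚ ∷ (p *P r)) +P (0ℚ ∷ (q *P r))) i
  ≡⟨ cong ((a Q.+ b) Q.* coeff r i Q.+_) (coeff-+ (0ℚ ∷ (p *P r)) (0ℚ ∷ (q *P r)) i) ⟩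
    (a Q.+ b) Q.* coeff r i Q.+ (coeff (0ℚ ∷ (p *P r)) i Q.+ coeff (0ℚ ∷ (q *P r)) i)
  ≡⟨ solve 5 (λ a b x y z → (a :+ b) :* x :+ (y :+ z) := (a :* x :+ y) :+ (b :* x :+ z)) refl a b (coeff r i) _ _ ⟩
    (a Q.* coeff r i Q.+ coeff (0ℚ ∷ (p *P r)) i) Q.+ (b Q.* coeff r i Q.+ coeff (0ℚ ∷ (q *P r)) i)
  ≡⟨ sym (cong₂ Q._+_ (coeff-* a p r i) (coeff-* b q r i)) ⟩
    coeff ((a ∷ p) *P r) i Q.+ coeff ((b ∷ q) *P r) i
  ≡⟨ sym (coeff-+ ((a ∷ p) *P r) _ i) ⟩
    coeff (((a ∷ p) *P r) +P ((b ∷ q) *P r)) i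
  ∎
  where open ≡-Reasoning

*-distribˡ : ∀ p q r → p *P (q +P r) ~ (p *P q) +P (p *P r)
*-distribˡ p q r =
  ~-trans (*-comm p (q +P r)) (~-trans (*-distribʳ q r p) (+-cong (*-comm q p) (*-comm r p)))

scale-* : ∀ a p r → map (a Q.*_) p *P r ~ map (a Q.*_) (p *P r)
scale-* a []      r = ~-refl
scale-* a (b ∷ p) r = mk~ λ i → begin
    coeff (((a Q.* b) ∷ map (a Q.*_) p) *P r) i
  ≡⟨ coeff-* (a Q.* b) (map (a Q.*_) p) r i ⟩
    a Q.* b Q.* coeff r i Q.+ coeff (0ℚ ∷ (map (a Q.*_) p *P r)) i
  ≡⟨ cong (a Q.* b Q.* coeff r i Q.+_) (coeff-≡ (~-trans (∷-cong refl (scale-* a p r)) (k·-scale a (p *P r))) i) ⟩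
    a Q.* b Q.* coeff r i Q.+ coeff (map (a Q.*_) (0ℚ ∷ (p *P r))) i
  ≡⟨ cong (a Q.* b Q.* coeff r i Q.+_) (coeff-scale a (0ℚ ∷ (p *P r)) i) ⟩
    a Q.* b Q.* coeff r i Q.+ a Q.* coeff (0ℚ ∷ (p *P r)) i
  ≡⟨ solve 4 (λ a b x y → a :* b :* x :+ a :* y := a :* (b :* x :+ y)) refl a b (coeff r i) _ ⟩
    a Q.* (b Q.* coeff r i Q.+ coeff (0ℚ ∷ (p *P r)) i)
  ≡⟨ cong (a Q.*_) (sym (coeff-* b p r i)) ⟩
    a Q.* coeff ((b ∷ p) *P r) i
  ≡⟨ sym (coeff-scale a ((b ∷ p) *P r) i) ⟩
    coeff (map (a Q.*_) ((b ∷ p) *P r)) i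
  ∎
  where open ≡-Reasoning

k·-* : ∀ p r → (0ℚ ∷ p) *P r ~ 0ℚ ∷ (p *P r)
k·-* p r = mk~ λ i → trans (coeff-* 0ℚ p r i)
  (trans (cong (Q._+ coeff (0ℚ ∷ (p *P r)) i) (QP.*-zeroˡ (coeff r i))) (QP.+-identityˡ _))

*-assoc : ∀ p q r → (p *P q) *P r ~ p *P (q *P r)
*-assoc []      q r = ~-refl
*-assoc (a ∷ p) q r = ~-trans (*-distribʳ (map (a Q.*_) q) (0ℚ ∷ (p *P q)) r)
  (+-cong (scale-* a q r) (~-trans (k·-* (p *P q) r) (∷-cong refl (*-assoc p q r))))

*-negʳ : ∀ p q → p *P (-P q) ~ -P (p *P q)
*-negʳ []      q = ~-refl
*-negʳ (a ∷ p) q = mk~ λ i → begin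
    coeff ((a ∷ p) *P (-P q)) i
  ≡⟨ coeff-* a p (-P q) i ⟩
    a Q.* coeff (-P q) i Q.+ coeff (0ℚ ∷ (p *P (-P q))) i
  ≡⟨ cong₂ Q._+_ (cong (a Q.*_) (coeff-neg q i)) (coeff-≡ (∷-cong refl (*-negʳ p q)) i) ⟩
    a Q.* (Q.- coeff q i) Q.+ coeff (-P (0ℚ ∷ (p *P q))) i
  ≡⟨ cong (a Q.* (Q.- coeff q i) Q.+_) (coeff-neg (0ℚ ∷ (p *P q)) i) ⟩
    a Q.* (Q.- coeff q i) Q.+ Q.- coeff (0ℚ ∷ (p *P q)) i
  ≡⟨ solve 3 (λ a x y → a :* (:- x) :+ (:- y) := :- (a :* x :+ y)) refl a (coeff q i) _ ⟩
    Q.- (a Q.* coeff q i Q.+ coeff (0ℚ ∷ (p *P q)) i)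
  ≡⟨ cong Q.-_ (sym (coeff-* a p q i)) ⟩
    Q.- coeff ((a ∷ p) *P q) i
  ≡⟨ sym (coeff-neg ((a ∷ p) *P q) i) ⟩
    coeff (-P ((a ∷ p) *P q)) i
  ∎
  where open ≡-Reasoning

*-identityˡ : ∀ p → (1ℚ ∷ []) *P p ~ p
*-identityˡ p = mk~ λ i → trans (coeff-* 1ℚ [] p i)
  (trans (cong₂ Q._+_ (QP.*-identityˡ (coeff p i)) (coeff-≡ (k·-zero ~-refl) i)) (QP.+-identityʳ _))

*-identityʳ : ∀ p → p *P (1ℚ ∷ []) ~ p
*-identityʳ p = ~-trans (*-comm p _) (*-identityˡ p)

*-k·ʳ : ∀ p q → p *P (0ℚ ∷ q) ~ 0ℚ ∷ (p *P q)
*-k·ʳ p q = ~-trans (*-comm p (0ℚ ∷ q)) (~-trans (k·-* q p) (∷-cong refl (*-comm q p)))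

*-negˡ : ∀ p q → (-P p) *P q ~ -P (p *P q)
*-negˡ p q = ~-trans (*-comm (-P p) q) (~-trans (*-negʳ q p) (neg-cong (*-comm q p)))

*-zeroˡ : ∀ p → (0ℚ ∷ []) *P p ~ []
*-zeroˡ p = *-absorbˡ p (k·-zero ~-refl)

IsZeroP⇔~[] : ∀ p → IsZeroP p ⇔ p ~ []
IsZeroP⇔~[] p = mk⇔ (to p) (from p)
  where
  to : ∀ p → IsZeroP p → p ~ []
  to []      []          = ~-refl
  to (a ∷ p) (a≡0 ∷ p≡0) = mk~ λ { zero → a≡0 ; (suc i) → coeff-≡ (to p p≡0) i }
  from : ∀ p → p ~ [] → IsZeroP p
  from []      e = []
  from (a ∷ p) e = coeff-≡ e zero ∷ from p (~[]-tail e)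

~[]⇔~ : ∀ p q → p +P (-P q) ~ [] ⇔ p ~ q
~[]⇔~ p q = mk⇔
  (λ e → mk~ λ i → x∙y⁻¹≈ε⇒x≈y _ _ (trans (sym (coeff-sub i)) (coeff-≡ e i)))
  (λ e → mk~ λ i → trans (coeff-sub i) (trans (cong (Q._- coeff q i) (coeff-≡ e i)) (QP.+-inverseʳ (coeff q i))))
  where
  open import Algebra.Properties.Group QP.+-0-group using (x∙y⁻¹≈ε⇒x≈y)
  coeff-sub : ∀ i → coeff (p +P (-P q)) i ≡ coeff p i Q.- coeff q i
  coeff-sub i = trans (coeff-+ p (-P q) i) (cong (coeff p i Q.+_) (coeff-neg q i))

≈P⇔~ : ∀ p q → p ≈P q ⇔ p ~ q
≈P⇔~ p q = ⇔-trans (IsZeroP⇔~[] (p +P (-P q))) (~[]⇔~ p q)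

x*c≡0⇒x≡0 : ∀ x c .{{_ : Q.NonZero c}} → x Q.* c ≡ 0ℚ → x ≡ 0ℚ
x*c≡0⇒x≡0 x c x*c≡0 = begin
  x                       ≡⟨ sym (QP.*-identityʳ x) ⟩
  x Q.* 1ℚ                ≡⟨ cong (x Q.*_) (sym (QP.*-inverseʳ c)) ⟩
  x Q.* (c Q.* Q.1/ c)    ≡⟨ sym (QP.*-assoc x c _) ⟩
  x Q.* c Q.* Q.1/ c      ≡⟨ cong (Q._* Q.1/ c) x*c≡0 ⟩
  0ℚ Q.* Q.1/ c           ≡⟨ QP.*-zeroˡ (Q.1/ c) ⟩
  0ℚ                      ∎
  where open ≡-Reasoning

-- a polynomial with nonzero constant term is not a zero divisor in ℚ[k]
-- (by induction on the other factor: its constant term must vanish first)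
*-cancel : ∀ c → Q.NonZero (coeff c 0) → ∀ z → c *P z ~ [] ⇔ z ~ []
*-cancel c nz z = mk⇔ (cancel z) (λ z~[] → ~-trans (*-comm c z) (*-absorbˡ c z~[]))
  where
  cancel : ∀ z → c *P z ~ [] → z ~ []
  cancel []      e = ~-refl
  cancel (a ∷ z) e = mk~ λ { zero → a≡0 ; (suc i) → coeff-≡ (cancel z cz~[]) i }
    where
    a·c₀≡0 : a Q.* coeff c 0 ≡ 0ℚ
    a·c₀≡0 = begin
      a Q.* coeff c 0                                    ≡⟨ sym (QP.+-identityʳ _) ⟩
      a Q.* coeff c 0 Q.+ 0ℚ                             ≡⟨ cong (Q._+ 0ℚ) (sym (coeff-scale a c 0)) ⟩
      coeff (map (a Q.*_) c) 0 Q.+ 0ℚ                    ≡⟨ sym (coeff-+ (map (a Q.*_) c) _ 0) ⟩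
      coeff (map (a Q.*_) c +P (0ℚ ∷ (c *P z))) 0        ≡⟨ sym (coeff-≡ (*-consʳ c a z) 0) ⟩
      coeff (c *P (a ∷ z)) 0                             ≡⟨ coeff-≡ e 0 ⟩
      0ℚ                                                 ∎
      where open ≡-Reasoning
    a≡0 : a ≡ 0ℚ
    a≡0 = x*c≡0⇒x≡0 a (coeff c 0) {{nz}} a·c₀≡0
    cz~[] : c *P z ~ []
    cz~[] = ~[]-tail (~-trans (~-sym (*-k·ʳ c z)) (subst (λ a → c *P (a ∷ z) ~ []) a≡0 e))

-- §4 Solving 1 - x·M = 0 in ℚ(k)

≈K-zero : ∀ z → z ≈K 0K ⇔ num z ~ []
≈K-zero z = ⇔-trans (≈P⇔~ _ _) (~-resp (*-identityʳ (num z)) (*-zeroˡ (den z)))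

0+x·z≈0 : ∀ x z → z ≈K 0K → 0K +K x *K z ≈K 0K
0+x·z≈0 (n // d) z z≈0 = Equivalence.from (≈K-zero (0K +K (n // d) *K z))
  (+-cong (*-zeroˡ (d *P den z))
          (~-trans (*-identityʳ (n *P num z)) (~-trans (*-congʳ n (Equivalence.to (≈K-zero z) z≈0)) (*-zeroʳ n))))

-- the two numerators arising from  1 + x·y  and  1 - x·M  (x = n/d, y = n_y/d_y,
-- M = n_M/d_M, y = -M) agree up to the factors d_M and d_y
numerators-relation : ∀ n d ny dy nM dM → ny *P dM ~ -P (nM *P dy) →
  dM *P ((d *P dy) +P (n *P ny)) ~ dy *P ((dM *P d) +P (-P (nM *P n)))
numerators-relation n d ny dy nM dM ny·dM≈-nM·dy = begin
  dM *P ((d *P dy) +P (n *P ny))                ≈⟨ *-distribˡ dM (d *P dy) (n *P ny) ⟩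
  (dM *P (d *P dy)) +P (dM *P (n *P ny))        ≈⟨ +-cong first second ⟩
  (dy *P (dM *P d)) +P (dy *P (-P (nM *P n)))   ≈⟨ ~-sym (*-distribˡ dy (dM *P d) (-P (nM *P n))) ⟩
  dy *P ((dM *P d) +P (-P (nM *P n)))           ∎
  where
  open SetoidReasoning ~-setoid
  first : dM *P (d *P dy) ~ dy *P (dM *P d)
  first = ~-trans (~-sym (*-assoc dM d dy)) (*-comm (dM *P d) dy)
  second : dM *P (n *P ny) ~ dy *P (-P (nM *P n))
  second = begin
    dM *P (n *P ny)       ≈⟨ *-comm dM (n *P ny) ⟩
    (n *P ny) *P dM       ≈⟨ *-assoc n ny dM ⟩
    n *P (ny *P dM)       ≈⟨ *-congʳ n ny·dM≈-nM·dy ⟩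
    n *P (-P (nM *P dy))  ≈⟨ *-negʳ n (nM *P dy) ⟩
    -P (n *P (nM *P dy))  ≈⟨ neg-cong (~-sym (*-assoc n nM dy)) ⟩
    -P ((n *P nM) *P dy)  ≈⟨ neg-cong (*-comm (n *P nM) dy) ⟩
    -P (dy *P (n *P nM))  ≈⟨ neg-cong (*-congʳ dy (*-comm n nM)) ⟩
    -P (dy *P (nM *P n))  ≈⟨ ~-sym (*-negʳ dy (nM *P n)) ⟩
    dy *P (-P (nM *P n))  ∎

-- Clearing denominators
-- (all with nonzero constant term, so that they cancel) turns both sides
-- into the vanishing of the numerators related by numerators-relation.
solve-1-xM : ∀ (a y M x : K) → a ≈K 1K → y ≈K -K M →
  Q.NonZero (coeff (den a) 0) → Q.NonZero (coeff (den y) 0) → Q.NonZero (coeff (den M) 0) →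
  (a +K x *K y ≈K 0K) ⇔ (x ≈K 1K /K M)
solve-1-xM (na // da) (ny // dy) (nM // dM) (n // d) a≈1 y≈-M da-nz dy-nz dM-nz = begin
  (na // da) +K (n // d) *K (ny // dy) ≈K 0K        ∼⟨ ≈K-zero _ ⟩
  (na *P (d *P dy)) +P ((n *P ny) *P da) ~ []        ∼⟨ ~-resp num≈da·A ~-refl ⟩
  da *P A ~ []                                       ∼⟨ *-cancel da da-nz A ⟩
  A ~ []                                             ∼⟨ ⇔-sym (*-cancel dM dM-nz A) ⟩
  dM *P A ~ []                                       ∼⟨ ~-resp (numerators-relation n d ny dy nM dM ny·dM≈-nM·dy) ~-refl ⟩
  dy *P D ~ []                                       ∼⟨ *-cancel dy dy-nz D ⟩
  D ~ []                                             ∼⟨ ~[]⇔~ (dM *P d) (nM *P n) ⟩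
  dM *P d ~ nM *P n                                  ∼⟨ ~-sym⇔ ⟩
  nM *P n ~ dM *P d                                  ∼⟨ ⇔-sym x≈1/M⇔ ⟩
  (n // d) ≈K 1K /K (nM // dM)                       ∎
  where
  open EquationalReasoning
  A D : Poly
  A = (d *P dy) +P (n *P ny)
  D = (dM *P d) +P (-P (nM *P n))

  na≈da : na ~ da
  na≈da = Equivalence.to (⇔-trans (≈P⇔~ _ _) (~-resp (*-identityʳ na) (*-identityˡ da))) a≈1

  ny·dM≈-nM·dy : ny *P dM ~ -P (nM *P dy)
  ny·dM≈-nM·dy = ~-trans (Equivalence.to (≈P⇔~ _ _) y≈-M) (*-negˡ nM dy)

  num≈da·A : (na *P (d *P dy)) +P ((n *P ny) *P da) ~ da *P A
  num≈da·A = ~-trans (+-cong (*-congˡ (d *P dy) na≈da) (*-comm (n *P ny) da))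
                     (~-sym (*-distribˡ da (d *P dy) (n *P ny)))

  x≈1/M⇔ : (n // d) ≈K 1K /K (nM // dM) ⇔ nM *P n ~ dM *P d
  x≈1/M⇔ = ⇔-trans (≈P⇔~ _ _)
    (~-resp (~-trans (*-congʳ n (*-identityˡ nM)) (*-comm n nM)) (*-congˡ d (*-identityˡ dM)))

-- §5 The low coefficients of Ψ(μ)φ

-- the coefficients of ψ²φ (from q^{k/2+1} on) and of Y = E₆Δ^{-1/2}ψφ - φ
-- (from q^{k/2} on), in steps of q^{1/2}
ψ²φ : ℕ → K
ψ²φ = coeffs (ψ (ψ φ))

Yφ : ℕ → K
Yφ = coeffs (((E6L *L Δ⁻½) *L ψ φ) +L (-L φ))

Ψφ-split : K → LS
Ψφ-split μ = mkLS (+ 2) ψ²φ +L scaleL μ (mkLS (+ 0) Yφ)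

Ψφ-shape : ∀ μ → Ψ μ φ ≡ Ψφ-split μ
Ψφ-shape μ = refl

low-coefficients : ∀ μ (F G : ℕ → K) → let s = mkLS (+ 2) F +L scaleL μ (mkLS (+ 0) G) in
  (coef s (+ (2 ℕ.* 0)) ≡ 0K +K μ *K G 0) × (coef s (+ (2 ℕ.* 1)) ≡ F 0 +K μ *K G 2)
low-coefficients μ F G = refl , refl

-- β₀ = μ·Y₀ and β₁ = (ψ²φ)₀ + μ·Y₁.  The middle terms are given explicitly so
-- that type checking compares the split form rather than unfolding the series.
β₀-formula : ∀ μ → β 0 μ ≡ 0K +K μ *K Yφ 0
β₀-formula μ = trans {i = β 0 μ} {j = coef (Ψφ-split μ) (+ (2 ℕ.* 0))} {k = 0K +K μ *K Yφ 0}
  (cong (λ s → coef s (+ (2 ℕ.* 0))) {Ψ μ φ} {Ψφ-split μ} (Ψφ-shape μ))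
  (proj₁ (low-coefficients μ ψ²φ Yφ))

β₁-formula : ∀ μ → β 1 μ ≡ ψ²φ 0 +K μ *K Yφ 2
β₁-formula μ = trans {i = β 1 μ} {j = coef (Ψφ-split μ) (+ (2 ℕ.* 1))} {k = ψ²φ 0 +K μ *K Yφ 2}
  (cong (λ s → coef s (+ (2 ℕ.* 1))) {Ψ μ φ} {Ψφ-split μ} (Ψφ-shape μ))
  (proj₂ (low-coefficients μ ψ²φ Yφ))

≈P-by-evaluation : ∀ p q → True (all? (λ c → c QP.≟ 0ℚ) (p +P (-P q))) → p ≈P q
≈P-by-evaluation p q = toWitness

μ*ₖ₊₁ : K
μ*ₖ₊₁ = μ* (kK +K 1K)

-- (ψ²φ)₀ = α₀(k+2) = 1
ψ²φ₀≈1 : ψ²φ 0 ≈K 1K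
ψ²φ₀≈1 = ≈P-by-evaluation (num (ψ²φ 0) *P den 1K) (num 1K *P den (ψ²φ 0)) _

-- Y₀ = α₀(k+1) - α₀(k) = 0
Yφ₀≈0 : Yφ 0 ≈K 0K
Yφ₀≈0 = ≈P-by-evaluation (num (Yφ 0) *P den 0K) (num 0K *P den (Yφ 0)) _

-- Y₁ = α₁(k+1) - α₁(k) + 12 - 504 = -μ*_{k+1}, the computation behind the lemma
Yφ₂≈-μ* : Yφ 2 ≈K -K μ*ₖ₊₁
Yφ₂≈-μ* = ≈P-by-evaluation (num (Yφ 2) *P den (-K μ*ₖ₊₁)) (num (-K μ*ₖ₊₁) *P den (Yφ 2)) _

ψ²φ₀-den : Q.NonZero (coeff (den (ψ²φ 0)) 0)
ψ²φ₀-den = _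

Yφ₂-den : Q.NonZero (coeff (den (Yφ 2)) 0)
Yφ₂-den = _

μ*-den : Q.NonZero (coeff (den μ*ₖ₊₁) 0)
μ*-den = _

lemma4p5 : (μ : K) → ValidK μ →
    (β 0 μ ≈K 0K) × (β 1 μ ≈K 0K ⇔ μ ≈K 1K /K μ* (kK +K 1K))
lemma4p5 μ _ = β₀≈0 , β₁≈0⇔
  where
  β₀≈0 : β 0 μ ≈K 0K
  β₀≈0 = subst (_≈K 0K) (sym (β₀-formula μ)) (0+x·z≈0 μ (Yφ 0) Yφ₀≈0)

  β₁≈0⇔ : β 1 μ ≈K 0K ⇔ μ ≈K 1K /K μ*ₖ₊₁
  β₁≈0⇔ = subst (λ b → b ≈K 0K ⇔ μ ≈K 1K /K μ*ₖ₊₁) (sym (β₁-formula μ))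
    (solve-1-xM (ψ²φ 0) (Yφ 2) μ*ₖ₊₁ μ ψ²φ₀≈1 Yφ₂≈-μ* ψ²φ₀-den Yφ₂-den μ*-den)
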